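{- Let $n\ge 1$ and let $T^3_n$ be the semigraph on vertices $v_1,\dots,v_{2n+1}$ with edge set $\{(v_1,v_{2i},v_{2i+1}) : 1\le i\le n\}$. Then the Laplacian spectrum of $T^3_n$ consists of $0$ (multiplicity $1$), $\frac{5+\sqrt5}{2}$ and $\frac{5-\sqrt5}{2}$ (each with multiplicity $n-1$), and $\lambda_1,\lambda_2$ (each multiplicity $1$), where $\lambda_1,\lambda_2$ are the roots of $\lambda^2-(3n+5)\lambda+10n+5$.
   Context: Semigraph terminology: edges are ordered tuples of distinct vertices identified with their reversals, distinct edges sharing at most one vertex; in $(u_1,\dots,u_p)$, $u_1,u_p$ are end vertices and the others middle vertices, $d_e(u_s,u_t)=|s-t|$. An edge both of whose end vertices are end vertices of every edge containing them is a full edge. For a semigraph all of whose edges are full, the adjacency matrix $A=(a_{st})$ has $a_{st}=d_e(v_s,v_t)$ if $v_s\ne v_t$ lie in a common edge $e$ and $a_{st}=0$ otherwise; the degree is $d_s=\sum_t a_{st}$ and the Laplacian is $L=\mathrm{diag}(d_s)-A$. In $T^3_n$ all edges are full, so the nonzero off-diagonal entries of $A$ are $a_{1,2i}=1$, $a_{1,2i+1}=2$, $a_{2i,2i+1}=1$, with degrees $d_1=3n$, $d_{2i}=2$, $d_{2i+1}=3$. The Laplacian spectrum is the multiset of eigenvalues of $L$. -}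

module Defs where

open import Data.Nat as ℕ using (ℕ; zero; suc)
open import Data.Integer as ℤ using (ℤ; +_; _-_; _*_; _+_; -_)
open import Data.Fin as Fin using (Fin; zero; suc; toℕ; punchIn; inject₁; fromℕ)
open import Data.List as List using (List; []; _∷_)
open import Data.Maybe using (Maybe; just; nothing)
open import Relation.Nullary using (yes; no)

Matrix : ℕ → Set
Matrix m = Fin m → Fin m → ℤ

∑ : ∀ {m} → (Fin m → ℤ) → ℤ
∑ {zero}  f = + 0
∑ {suc m} f = f zero + ∑ (λ i → f (suc i))

sign : ℕ → ℤ
sign zero    = + 1
sign (suc k) = - sign k

minor : ∀ {m} → Matrix (suc m) → Fin (suc m) → Matrix m
minor M j i k = M (suc i) (punchIn j k)

det : ∀ {m} → Matrix m → ℤ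
det {zero}  M = + 1
det {suc m} M = ∑ (λ j → sign (toℕ j) * M zero j * det (minor M j))

-- Semigraphs on vertex set Fin m.  An edge (u₁,…,u_p) is a list of
-- distinct vertices.

Edge : ℕ → Set
Edge m = List (Fin m)

record Semigraph (m : ℕ) : Set where
  field
    edges : List (Edge m)

position : ∀ {m} → Fin m → Edge m → Maybe ℕ
position v []       = nothing
position v (u ∷ us) with v Fin.≟ u
... | yes _ = just zero
... | no  _ with position v us
...   | just k  = just (suc k)
...   | nothing = nothing

edgeDist : ∀ {m} → Edge m → Fin m → Fin m → ℕ
edgeDist e s t with position s e | position t e
... | just p | just q = ℕ.∣ p - q ∣
... | _      | _      = 0

-- Adjacency matrix of a semigraph all of whose edges are full:
-- a_st = d_e(v_s,v_t) for the (unique, since distinct edges share at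
-- most one vertex) edge e containing both, and 0 otherwise (also 0 on
-- the diagonal since d_e(v,v) = 0).
adjacency : ∀ {m} → Semigraph m → Matrix m
adjacency G s t = List.foldr (λ e acc → + edgeDist e s t + acc) (+ 0) (Semigraph.edges G)

degree : ∀ {m} → Semigraph m → Fin m → ℤ
degree G s = ∑ (λ t → adjacency G s t)

δ : ∀ {m} → Fin m → Fin m → ℤ
δ i j with i Fin.≟ j
... | yes _ = + 1
... | no  _ = + 0

laplacian : ∀ {m} → Semigraph m → Matrix m
laplacian G s t = δ s t * degree G s - adjacency G s t

laplacianCharPoly : ∀ {m} → Semigraph m → ℤ → ℤ
laplacianCharPoly G x = det (λ s t → δ s t * x - laplacian G s t)

-- The semigraph T³ₙ on vertices v₁,…,v_{2n+1} (index k ↔ v_{k+1}),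
-- edges (v₁, v_{2i}, v_{2i+1}) for 1 ≤ i ≤ n.

V : ℕ → ℕ
V zero    = 1
V (suc n) = suc (suc (V n))

T3edges : (n : ℕ) → List (Edge (V n))
T3edges zero    = []
T3edges (suc n) =
  (zero ∷ inject₁ (fromℕ (V n)) ∷ fromℕ (suc (V n)) ∷ [])
  ∷ List.map (List.map (λ v → inject₁ (inject₁ v))) (T3edges n)

T3 : (n : ℕ) → Semigraph (V n)
T3 n = record { edges = T3edges n }

-- Indexing the hub first, x·I − L(T³ₙ) is an arrow matrix: the hub row (x − 3n, 1, 2, 1, 2, …),
-- its transpose as first column, and n copies of B₀ = [[x − 2, 1], [1, x − 3]] on the diagonal,
-- with det B₀ = x² − 5x + 5 =: D.  Scaling the hub row by D and adding −(1, 2)·adj B₀ times the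
-- rows of each block clears the hub row off the diagonal, leaving there
-- D(x − 3n) − 5n(x − 3) = x(x² − (3n+5)x + 10n + 5); expanding along it gives
-- D · det = x(x² − (3n+5)x + 10n + 5) · Dⁿ.  D has no integer root (4D + 5 = (2x − 5)² and 5 is
-- not a square), so it cancels.  The row operation is justified from the first-row Laplace
-- expansion defining det: it is linear in the first row, and vanishes when the first row repeats
-- another one, by antisymmetry of the expansion along two rows.
module Submission where

open import Defs
open import Data.Nat as ℕ using (ℕ; zero; suc; _≤_; _∸_)
open import Data.Nat.Properties as ℕ using ()
open import Data.Integer as ℤ using (ℤ; +_; -[1+_]; _-_; _*_; _+_; -_; _^_)
open import Data.Integer.Properties as ℤ using ()
open import Data.Integer.Tactic.RingSolver using (solve-∀)
open import Algebra.Properties.CommutativeSemigroup ℤ.+-commutativeSemigroup using ()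
  renaming (interchange to +-interchange)
open import Data.Fin as Fin using (Fin; zero; suc; toℕ; punchIn; lift; inject₁; fromℕ)
open import Data.Fin.Properties as Fin using ()
open import Data.List as List using (List; []; _∷_)
open import Data.Maybe as Maybe using (Maybe; just; nothing)
open import Function using (_∘_)
open import Function.Definitions using (Injective)
open import Relation.Nullary using (Dec; yes; no; contradiction)
open import Relation.Nullary.Decidable using (from-no)
open import Relation.Binary.Core using (_Preserves_⟶_)
open import Relation.Binary.PropositionalEquality

∑-cong : ∀ {m} {f g : Fin m → ℤ} → f ≗ g → ∑ f ≡ ∑ g
∑-cong {zero}  f≗g = refl
∑-cong {suc m} f≗g = cong₂ _+_ (f≗g zero) (∑-cong (f≗g ∘ suc))

∑-zero : ∀ {m} {f : Fin m → ℤ} → (∀ i → f i ≡ + 0) → ∑ f ≡ + 0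
∑-zero {zero}  f≡0 = refl
∑-zero {suc m} f≡0 = cong₂ _+_ (f≡0 zero) (∑-zero (f≡0 ∘ suc))

∑-distrib-+ : ∀ {m} (f g : Fin m → ℤ) → ∑ (λ i → f i + g i) ≡ ∑ f + ∑ g
∑-distrib-+ {zero}  f g = refl
∑-distrib-+ {suc m} f g =
  trans (cong (_+_ (f zero + g zero)) (∑-distrib-+ (f ∘ suc) (g ∘ suc)))
        (+-interchange (f zero) (g zero) (∑ (f ∘ suc)) (∑ (g ∘ suc)))

∑-*ˡ : ∀ {m} a (f : Fin m → ℤ) → ∑ (λ i → a * f i) ≡ a * ∑ f
∑-*ˡ {zero}  a f = sym (ℤ.*-zeroʳ a)
∑-*ˡ {suc m} a f =
  trans (cong (_+_ (a * f zero)) (∑-*ˡ a (f ∘ suc))) (sym (ℤ.*-distribˡ-+ a (f zero) (∑ (f ∘ suc))))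

∑-neg : ∀ {m} (f : Fin m → ℤ) → ∑ (λ i → - f i) ≡ - ∑ f
∑-neg {zero}  f = refl
∑-neg {suc m} f =
  trans (cong (_+_ (- f zero)) (∑-neg (f ∘ suc))) (sym (ℤ.neg-distrib-+ (f zero) (∑ (f ∘ suc))))

∑-comm : ∀ {m n} (f : Fin m → Fin n → ℤ) → ∑ (λ i → ∑ (f i)) ≡ ∑ (λ j → ∑ (λ i → f i j))
∑-comm {zero}  {n} f = sym (∑-zero {n} (λ _ → refl))
∑-comm {suc m}     f = trans (cong (_+_ (∑ (f zero))) (∑-comm (f ∘ suc))) (sym (∑-distrib-+ (f zero) _))

det-cong : ∀ {m} {M N : Matrix m} → (∀ i j → M i j ≡ N i j) → det M ≡ det N
det-cong {zero}  M≡N = refl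
det-cong {suc m} M≡N = ∑-cong λ j →
  cong₂ _*_ (cong (sign (toℕ j) *_) (M≡N zero j)) (det-cong λ i k → M≡N (suc i) (punchIn j k))

-- Laplace expansion along two rows u and v; Φ c plays the determinant of the remaining rows
-- restricted to the columns c.
twoRowExpansion : ∀ {m} (u v : Fin (suc (suc m)) → ℤ) → ((Fin m → Fin (suc (suc m))) → ℤ) → ℤ
twoRowExpansion u v Φ =
  ∑ λ j → sign (toℕ j) * u j * ∑ λ k → sign (toℕ k) * v (punchIn j k) * Φ (punchIn j ∘ punchIn k)

expansionOffColumn0 : ∀ {m} → ((Fin m → Fin (suc (suc m))) → ℤ) → (Fin (suc (suc m)) → ℤ) → ℤ
expansionOffColumn0 Φ w = ∑ λ k → sign (toℕ k) * w (suc k) * Φ (suc ∘ punchIn k)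

-- Φ only has to respect pointwise equality, as punchIn (suc j) ∘ punchIn (suc k) and
-- lift 1 (punchIn j ∘ punchIn k) agree only pointwise.
twoRowExpansion-column0 : ∀ {m} (u v : Fin (suc (suc (suc m))) → ℤ)
  (Φ : (Fin (suc m) → Fin (suc (suc (suc m)))) → ℤ) → Φ Preserves _≗_ ⟶ _≡_ →
  twoRowExpansion u v Φ
    ≡ u zero * expansionOffColumn0 Φ v - v zero * expansionOffColumn0 Φ u
      + twoRowExpansion (u ∘ suc) (v ∘ suc) (Φ ∘ lift 1)
twoRowExpansion-column0 {m} u v Φ Φ-resp = begin
  + 1 * u zero * S v + ∑ (λ j → - σ j * u (suc j) * (+ 1 * v zero * A′ j + I j))
    ≡⟨ cong (_+_ (+ 1 * u zero * S v)) (∑-cong term) ⟩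
  + 1 * u zero * S v + ∑ (λ j → - v zero * A j + σ j * u (suc j) * I′ j)
    ≡⟨ cong (_+_ (+ 1 * u zero * S v)) (∑-distrib-+ (λ j → - v zero * A j) (λ j → σ j * u (suc j) * I′ j)) ⟩
  + 1 * u zero * S v + (∑ (λ j → - v zero * A j) + E′)
    ≡⟨ cong (λ z → + 1 * u zero * S v + (z + E′)) (∑-*ˡ (- v zero) A) ⟩
  + 1 * u zero * S v + (- v zero * S u + E′)
    ≡⟨ regroup (u zero) (S v) (v zero) (S u) E′ ⟩
  u zero * S v - v zero * S u + E′ ∎
  where
  open ≡-Reasoning
  σ : ∀ {n} → Fin n → ℤ
  σ j = sign (toℕ j)
  S = expansionOffColumn0 Φ
  E′ = twoRowExpansion (u ∘ suc) (v ∘ suc) (Φ ∘ lift 1)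
  A′ A I I′ : Fin (suc (suc m)) → ℤ
  A′ j = Φ (suc ∘ punchIn j)
  A  j = σ j * u (suc j) * A′ j
  I  j = ∑ λ k → - σ k * v (suc (punchIn j k)) * Φ (punchIn (suc j) ∘ punchIn (suc k))
  I′ j = ∑ λ k → σ k * v (suc (punchIn j k)) * Φ (lift 1 (punchIn j ∘ punchIn k))
  lift-punchIn : ∀ j k → punchIn (suc j) ∘ punchIn (suc k) ≗ lift 1 (punchIn j ∘ punchIn k)
  lift-punchIn j k zero    = refl
  lift-punchIn j k (suc l) = refl
  I≡-I′ : ∀ j → I j ≡ - I′ j
  I≡-I′ j = trans (∑-cong λ k → trans (cong (- σ k * v (suc (punchIn j k)) *_) (Φ-resp (lift-punchIn j k)))
                                       (neg-* (σ k) _ _))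
                  (∑-neg λ k → σ k * v (suc (punchIn j k)) * Φ (lift 1 (punchIn j ∘ punchIn k)))
    where
    neg-* : ∀ a b c → - a * b * c ≡ - (a * b * c)
    neg-* = solve-∀
  term : ∀ j → - σ j * u (suc j) * (+ 1 * v zero * A′ j + I j) ≡ - v zero * A j + σ j * u (suc j) * I′ j
  term j rewrite I≡-I′ j = ring (σ j) (u (suc j)) (v zero) (A′ j) (I′ j)
    where
    ring : ∀ s a b φ i → - s * a * (+ 1 * b * φ + - i) ≡ - b * (s * a * φ) + s * a * i
    ring = solve-∀
  regroup : ∀ a s b t e → + 1 * a * s + (- b * t + e) ≡ a * s - b * t + e
  regroup = solve-∀

twoRowExpansion-antisym : ∀ {m} (u v : Fin (suc (suc m)) → ℤ) (Φ : (Fin m → Fin (suc (suc m))) → ℤ) →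
  Φ Preserves _≗_ ⟶ _≡_ → twoRowExpansion u v Φ ≡ - twoRowExpansion v u Φ
twoRowExpansion-antisym {zero} u v Φ _ =
  -- both column selections out of Fin 0 reduce to λ l → suc (suc l)
  ring (u zero) (u (suc zero)) (v zero) (v (suc zero)) (Φ (punchIn zero ∘ punchIn zero))
  where
  ring : ∀ a b c d φ → + 1 * a * (+ 1 * d * φ + + 0) + (- + 1 * b * (+ 1 * c * φ + + 0) + + 0)
                     ≡ - (+ 1 * c * (+ 1 * b * φ + + 0) + (- + 1 * d * (+ 1 * a * φ + + 0) + + 0))
  ring = solve-∀
twoRowExpansion-antisym {suc m} u v Φ Φ-resp = begin
  twoRowExpansion u v Φ                   ≡⟨ twoRowExpansion-column0 u v Φ Φ-resp ⟩
  u zero * S v - v zero * S u + E′ u v    ≡⟨ cong (_+_ (u zero * S v - v zero * S u))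
                                                   (twoRowExpansion-antisym (u ∘ suc) (v ∘ suc) (Φ ∘ lift 1) Φ′-resp) ⟩
  u zero * S v - v zero * S u - E′ v u    ≡⟨ regroup (u zero) (S v) (v zero) (S u) (E′ v u) ⟩
  - (v zero * S u - u zero * S v + E′ v u) ≡⟨ cong -_ (twoRowExpansion-column0 v u Φ Φ-resp) ⟨
  - twoRowExpansion v u Φ                 ∎
  where
  open ≡-Reasoning
  S = expansionOffColumn0 Φ
  E′ : (Fin (suc (suc (suc m))) → ℤ) → (Fin (suc (suc (suc m))) → ℤ) → ℤ
  E′ u v = twoRowExpansion (u ∘ suc) (v ∘ suc) (Φ ∘ lift 1)
  Φ′-resp : (Φ ∘ lift 1) Preserves _≗_ ⟶ _≡_
  Φ′-resp s≗t = Φ-resp λ { zero → refl ; (suc l) → cong suc (s≗t l) }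
  regroup : ∀ a s b t e → a * s - b * t + - e ≡ - (b * t - a * s + e)
  regroup = solve-∀

swapRows01 : ∀ {m} → Matrix (suc (suc m)) → Matrix (suc (suc m))
swapRows01 M zero          = M (suc zero)
swapRows01 M (suc zero)    = M zero
swapRows01 M (suc (suc i)) = M (suc (suc i))

det-swapRows01 : ∀ {m} (M : Matrix (suc (suc m))) → det (swapRows01 M) ≡ - det M
det-swapRows01 M = twoRowExpansion-antisym (M (suc zero)) (M zero) (λ c → det λ i l → M (suc (suc i)) (c l))
                                           (λ c≗d → det-cong λ i l → cong (M (suc (suc i))) (c≗d l))

det-minors≡0 : ∀ {m} (M : Matrix (suc m)) → (∀ j → det (minor M j) ≡ + 0) → det M ≡ + 0
det-minors≡0 M minors≡0 = ∑-zero λ j →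
  trans (cong (sign (toℕ j) * M zero j *_) (minors≡0 j)) (ℤ.*-zeroʳ (sign (toℕ j) * M zero j))

i≡-i⇒i≡0 : ∀ i → i ≡ - i → i ≡ + 0
i≡-i⇒i≡0 (+ zero)  _ = refl
i≡-i⇒i≡0 (+ suc n) ()
i≡-i⇒i≡0 -[1+ n ]  ()

det-equalRows : ∀ {m} (M : Matrix m) {i j : Fin m} → i Fin.< j → (∀ k → M i k ≡ M j k) → det M ≡ + 0
det-equalRows {suc (suc m)} M {zero} {suc zero} _ M₀≡M₁ =
  i≡-i⇒i≡0 (det M) (trans (det-cong {M = M} {N = swapRows01 M} rowsAgree) (det-swapRows01 M))
  where
  rowsAgree : ∀ i k → M i k ≡ swapRows01 M i k
  rowsAgree zero          k = M₀≡M₁ k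
  rowsAgree (suc zero)    k = sym (M₀≡M₁ k)
  rowsAgree (suc (suc i)) k = refl
det-equalRows {suc (suc m)} M {zero} {suc (suc j)} _ M₀≡Mⱼ = begin
  det M                ≡⟨ ℤ.neg-involutive (det M) ⟨
  - - det M            ≡⟨ cong -_ (det-swapRows01 M) ⟨
  - det (swapRows01 M) ≡⟨ cong -_ (det-minors≡0 (swapRows01 M) λ c →
                            det-equalRows (minor (swapRows01 M) c) {zero} {suc j} ℕ.z<s (M₀≡Mⱼ ∘ punchIn c)) ⟩
  + 0                  ∎
  where open ≡-Reasoning
det-equalRows {suc m} M {suc i} {suc j} i<j Mᵢ≡Mⱼ =
  det-minors≡0 M λ c → det-equalRows (minor M c) (ℕ.s<s⁻¹ i<j) (Mᵢ≡Mⱼ ∘ punchIn c)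

rowExpansion : ∀ {m} → Matrix (suc m) → (Fin (suc m) → ℤ) → ℤ
rowExpansion M w = ∑ λ j → sign (toℕ j) * w j * det (minor M j)

rowExpansion-lowerRow≡0 : ∀ {m} (M : Matrix (suc m)) i → rowExpansion M (M (suc i)) ≡ + 0
rowExpansion-lowerRow≡0 M i =
  det-equalRows (λ { zero → M (suc i) ; (suc r) → M (suc r) }) {zero} {suc i} ℕ.z<s (λ _ → refl)

rowExpansion-linear : ∀ {m n} (M : Matrix (suc m)) d (w : Fin (suc m) → ℤ)
  (c : Fin n → ℤ) (W : Fin n → Fin (suc m) → ℤ) →
  rowExpansion M (λ j → d * w j + ∑ λ i → c i * W i j)
    ≡ d * rowExpansion M w + ∑ λ i → c i * rowExpansion M (W i)
rowExpansion-linear {m} M d w c W = begin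
  ∑ (λ j → σ j * (d * w j + ∑ λ i → c i * W i j) * C j)
    ≡⟨ ∑-cong distribute ⟩
  ∑ (λ j → d * t j + ∑ λ i → c i * T i j)
    ≡⟨ ∑-distrib-+ (λ j → d * t j) (λ j → ∑ λ i → c i * T i j) ⟩
  ∑ (λ j → d * t j) + ∑ (λ j → ∑ λ i → c i * T i j)
    ≡⟨ cong₂ _+_ (∑-*ˡ d t) (∑-comm λ j i → c i * T i j) ⟩
  d * ∑ t + ∑ (λ i → ∑ λ j → c i * T i j)
    ≡⟨ cong (_+_ (d * ∑ t)) (∑-cong λ i → ∑-*ˡ (c i) (T i)) ⟩
  d * ∑ t + ∑ (λ i → c i * ∑ (T i)) ∎
  where
  open ≡-Reasoning
  σ C t : Fin (suc m) → ℤ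
  σ j = sign (toℕ j)
  C j = det (minor M j)
  t j = σ j * w j * C j
  T : _ → Fin (suc m) → ℤ
  T i j = σ j * W i j * C j
  distribute : ∀ j → σ j * (d * w j + ∑ λ i → c i * W i j) * C j ≡ d * t j + ∑ λ i → c i * T i j
  distribute j = begin
    σ j * (d * w j + ∑ λ i → c i * W i j) * C j
      ≡⟨ ring (σ j) d (w j) (C j) (∑ λ i → c i * W i j) ⟩
    d * t j + σ j * C j * ∑ (λ i → c i * W i j)
      ≡⟨ cong (_+_ (d * t j)) (∑-*ˡ (σ j * C j) λ i → c i * W i j) ⟨
    d * t j + ∑ (λ i → σ j * C j * (c i * W i j))
      ≡⟨ cong (_+_ (d * t j)) (∑-cong λ i → reassoc (σ j) (C j) (c i) (W i j)) ⟩
    d * t j + ∑ (λ i → c i * T i j) ∎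
    where
    ring : ∀ s d w c x → s * (d * w + x) * c ≡ d * (s * w * c) + s * c * x
    ring = solve-∀
    reassoc : ∀ s c a b → s * c * (a * b) ≡ a * (s * b * c)
    reassoc = solve-∀

rowExpansion-sparse : ∀ {m} (M : Matrix (suc m)) (w : Fin (suc m) → ℤ) → (∀ k → w (suc k) ≡ + 0) →
  rowExpansion M w ≡ w zero * det (minor M zero)
rowExpansion-sparse M w w≡0 = begin
  + 1 * w zero * det (minor M zero) + ∑ (λ k → sign (toℕ (suc k)) * w (suc k) * det (minor M (suc k)))
    ≡⟨ cong (_+_ (+ 1 * w zero * det (minor M zero)))
            (∑-zero λ k → vanish (sign (toℕ (suc k))) (det (minor M (suc k))) (w≡0 k)) ⟩
  + 1 * w zero * det (minor M zero) + + 0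
    ≡⟨ ring (w zero) (det (minor M zero)) ⟩
  w zero * det (minor M zero) ∎
  where
  open ≡-Reasoning
  vanish : ∀ s c {a} → a ≡ + 0 → s * a * c ≡ + 0
  vanish s c refl = cong (_* c) (ℤ.*-zeroʳ s)
  ring : ∀ a c → + 1 * a * c + + 0 ≡ a * c
  ring = solve-∀

det-eliminateRow0 : ∀ {m} (M : Matrix (suc m)) d (c : Fin m → ℤ) →
  (∀ k → d * M zero (suc k) + ∑ (λ i → c i * M (suc i) (suc k)) ≡ + 0) →
  d * det M ≡ (d * M zero zero + ∑ λ i → c i * M (suc i) zero) * det (minor M zero)
det-eliminateRow0 M d c eliminated = begin
  d * det M                                                       ≡⟨ ℤ.+-identityʳ (d * det M) ⟨
  d * det M + + 0                                                 ≡⟨ cong (_+_ (d * det M)) lowerRows≡0 ⟨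
  d * rowExpansion M (M zero) + ∑ (λ i → c i * rowExpansion M (M (suc i)))
                                                                  ≡⟨ rowExpansion-linear M d (M zero) c (M ∘ suc) ⟨
  rowExpansion M newRow0                                          ≡⟨ rowExpansion-sparse M newRow0 eliminated ⟩
  (d * M zero zero + ∑ (λ i → c i * M (suc i) zero)) * det (minor M zero) ∎
  where
  open ≡-Reasoning
  newRow0 : Fin _ → ℤ
  newRow0 j = d * M zero j + ∑ λ i → c i * M (suc i) j
  lowerRows≡0 : ∑ (λ i → c i * rowExpansion M (M (suc i))) ≡ + 0
  lowerRows≡0 = ∑-zero λ i → trans (cong (c i *_) (rowExpansion-lowerRow≡0 M i)) (ℤ.*-zeroʳ (c i))

double : ℕ → ℕ
double zero    = zero
double (suc n) = suc (suc (double n))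

toMatrix : ∀ {m} → (ℕ → ℕ → ℤ) → Matrix m
toMatrix K i j = K (toℕ i) (toℕ j)

∑-periodic : (f : ℕ → ℤ) → (∀ a → f (suc (suc a)) ≡ f a) → ∀ n → ∑ {double n} (f ∘ toℕ) ≡ + n * (f 0 + f 1)
∑-periodic f periodic zero    = refl
∑-periodic f periodic (suc n) = begin
  f 0 + (f 1 + ∑ {double n} (λ i → f (suc (suc (toℕ i)))))
    ≡⟨ cong (λ r → f 0 + (f 1 + r)) (trans (∑-cong {double n} (periodic ∘ toℕ)) (∑-periodic f periodic n)) ⟩
  f 0 + (f 1 + + n * (f 0 + f 1))       ≡⟨ ring (f 0) (f 1) (+ n) ⟩
  + 1 * (f 0 + f 1) + + n * (f 0 + f 1) ≡⟨ ℤ.*-distribʳ-+ (f 0 + f 1) (+ 1) (+ n) ⟨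
  + suc n * (f 0 + f 1)                 ∎
  where
  open ≡-Reasoning
  ring : ∀ a b N → a + (b + N * (a + b)) ≡ + 1 * (a + b) + N * (a + b)
  ring = solve-∀

det-blockLowerTriangular : (K : ℕ → ℕ → ℤ) →
  (∀ a b → K (suc (suc a)) (suc (suc b)) ≡ K a b) →
  (∀ b → K 0 (suc (suc b)) ≡ + 0) → (∀ b → K 1 (suc (suc b)) ≡ + 0) →
  ∀ n → det (toMatrix {double n} K) ≡ (K 0 0 * K 1 1 - K 0 1 * K 1 0) ^ n
det-blockLowerTriangular K periodic row₀ row₁ zero    = refl
det-blockLowerTriangular K periodic row₀ row₁ (suc n) = begin
  + 1 * K 0 0 * det (minor B zero) + (- + 1 * K 0 1 * det (minor B (suc zero)) + rest)
    ≡⟨ cong₂ (λ a b → + 1 * K 0 0 * a + (- + 1 * K 0 1 * b + rest)) minor₀ minor₁ ⟩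
  + 1 * K 0 0 * (K 1 1 * X) + (- + 1 * K 0 1 * (K 1 0 * X) + rest)
    ≡⟨ cong (λ r → + 1 * K 0 0 * (K 1 1 * X) + (- + 1 * K 0 1 * (K 1 0 * X) + r)) rest≡0 ⟩
  + 1 * K 0 0 * (K 1 1 * X) + (- + 1 * K 0 1 * (K 1 0 * X) + + 0)
    ≡⟨ ring (K 0 0) (K 0 1) (K 1 0) (K 1 1) X ⟩
  (K 0 0 * K 1 1 - K 0 1 * K 1 0) * X
    ≡⟨ cong ((K 0 0 * K 1 1 - K 0 1 * K 1 0) *_) (det-blockLowerTriangular K periodic row₀ row₁ n) ⟩
  (K 0 0 * K 1 1 - K 0 1 * K 1 0) ^ suc n ∎
  where
  open ≡-Reasoning
  B : Matrix (suc (suc (double n)))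
  B = toMatrix K
  X = det (toMatrix {double n} K)
  rest = ∑ λ j → sign (toℕ (suc (suc j))) * K 0 (suc (suc (toℕ j))) * det (minor B (suc (suc j)))
  rest≡0 : rest ≡ + 0
  rest≡0 = ∑-zero λ j →
    trans (cong (λ a → sign (toℕ (suc (suc j))) * a * det (minor B (suc (suc j)))) (row₀ (toℕ j)))
          (cong (_* det (minor B (suc (suc j)))) (ℤ.*-zeroʳ (sign (toℕ (suc (suc j))))))
  lowerBlocks : det (toMatrix {double n} λ a b → K (suc (suc a)) (suc (suc b))) ≡ X
  lowerBlocks = det-cong {double n} λ i k → periodic (toℕ i) (toℕ k)
  minor₀ : det (minor B zero) ≡ K 1 1 * X
  minor₀ = trans (rowExpansion-sparse (minor B zero) (minor B zero zero) (row₁ ∘ toℕ)) (cong (K 1 1 *_) lowerBlocks)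
  minor₁ : det (minor B (suc zero)) ≡ K 1 0 * X
  minor₁ = trans (rowExpansion-sparse (minor B (suc zero)) (minor B (suc zero) zero) (row₁ ∘ toℕ)) (cong (K 1 0 *_) lowerBlocks)
  ring : ∀ a b c d X → + 1 * a * (d * X) + (- + 1 * b * (c * X) + + 0) ≡ (a * d - b * c) * X
  ring = solve-∀

maybeDist : Maybe ℕ → Maybe ℕ → ℕ
maybeDist (just p) (just q) = ℕ.∣ p - q ∣
maybeDist _        _        = 0

maybeDist-nothingʳ : ∀ x → maybeDist x nothing ≡ 0
maybeDist-nothingʳ (just _) = refl
maybeDist-nothingʳ nothing  = refl

edgeDist≡maybeDist : ∀ {m} (e : Edge m) s t → edgeDist e s t ≡ maybeDist (position s e) (position t e)
edgeDist≡maybeDist e s t with position s e | position t e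
... | just p  | just q  = refl
... | just p  | nothing = refl
... | nothing | _       = refl

position-here : ∀ {m} (v u : Fin m) us → v ≡ u → position v (u ∷ us) ≡ just 0
position-here v u us v≡u with v Fin.≟ u
... | yes _   = refl
... | no  v≢u = contradiction v≡u v≢u

position-there : ∀ {m} (v u : Fin m) us → v ≢ u → position v (u ∷ us) ≡ Maybe.map suc (position v us)
position-there v u us v≢u with v Fin.≟ u
... | yes v≡u = contradiction v≡u v≢u
... | no  _ with position v us
...   | just k  = refl
...   | nothing = refl

position-relabel : ∀ {m m′} {f : Fin m → Fin m′} → Injective _≡_ _≡_ f →
  ∀ v (e : Edge m) → position (f v) (List.map f e) ≡ position v e
position-relabel f-inj v []                = refl
position-relabel {f = f} f-inj v (u ∷ us) = by-cases (v Fin.≟ u)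
  where
  open ≡-Reasoning
  by-cases : Dec (v ≡ u) → position (f v) (List.map f (u ∷ us)) ≡ position v (u ∷ us)
  by-cases (yes v≡u) = trans (position-here (f v) (f u) _ (cong f v≡u)) (sym (position-here v u us v≡u))
  by-cases (no  v≢u) = begin
    position (f v) (f u ∷ List.map f us)           ≡⟨ position-there (f v) (f u) _ (v≢u ∘ f-inj) ⟩
    Maybe.map suc (position (f v) (List.map f us)) ≡⟨ cong (Maybe.map suc) (position-relabel f-inj v us) ⟩
    Maybe.map suc (position v us)                  ≡⟨ position-there v u us v≢u ⟨
    position v (u ∷ us)                            ∎

position-outside : ∀ {m m′} {f : Fin m → Fin m′} {v} → (∀ u → v ≢ f u) →
  (e : Edge m) → position v (List.map f e) ≡ nothing
position-outside                 v∉f []       = refl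
position-outside {f = f} {v = v} v∉f (u ∷ us) =
  trans (position-there v (f u) _ (v∉f u)) (cong (Maybe.map suc) (position-outside v∉f us))

⟨_⟩ : ∀ {m} → List (Edge m) → Semigraph m
⟨ es ⟩ = record { edges = es }

adjacency-relabel : ∀ {m m′} {f : Fin m → Fin m′} → Injective _≡_ _≡_ f →
  ∀ (es : List (Edge m)) a b → adjacency ⟨ List.map (List.map f) es ⟩ (f a) (f b) ≡ adjacency ⟨ es ⟩ a b
adjacency-relabel f-inj []                 a b = refl
adjacency-relabel {f = f} f-inj (e ∷ es) a b = cong₂ (λ d r → + d + r) edgeDist-relabel (adjacency-relabel f-inj es a b)
  where
  open ≡-Reasoning
  edgeDist-relabel : edgeDist (List.map f e) (f a) (f b) ≡ edgeDist e a b
  edgeDist-relabel = begin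
    edgeDist (List.map f e) (f a) (f b)
      ≡⟨ edgeDist≡maybeDist (List.map f e) (f a) (f b) ⟩
    maybeDist (position (f a) (List.map f e)) (position (f b) (List.map f e))
      ≡⟨ cong₂ maybeDist (position-relabel f-inj a e) (position-relabel f-inj b e) ⟩
    maybeDist (position a e) (position b e)
      ≡⟨ edgeDist≡maybeDist e a b ⟨
    edgeDist e a b ∎

adjacency-outsideˡ : ∀ {m m′} {f : Fin m → Fin m′} {s} → (∀ u → s ≢ f u) →
  ∀ (es : List (Edge m)) t → adjacency ⟨ List.map (List.map f) es ⟩ s t ≡ + 0
adjacency-outsideˡ                 s∉f []       t = refl
adjacency-outsideˡ {f = f} {s = s} s∉f (e ∷ es) t = cong₂ (λ d r → + d + r)
  (trans (edgeDist≡maybeDist (List.map f e) s t) (cong (λ p → maybeDist p _) (position-outside s∉f e)))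
  (adjacency-outsideˡ s∉f es t)

adjacency-outsideʳ : ∀ {m m′} {f : Fin m → Fin m′} {t} → (∀ u → t ≢ f u) →
  ∀ (es : List (Edge m)) s → adjacency ⟨ List.map (List.map f) es ⟩ s t ≡ + 0
adjacency-outsideʳ                 t∉f []       s = refl
adjacency-outsideʳ {f = f} {t = t} t∉f (e ∷ es) s = cong₂ (λ d r → + d + r)
  (trans (edgeDist≡maybeDist (List.map f e) s t)
         (trans (cong (maybeDist sₑ) (position-outside t∉f e)) (maybeDist-nothingʳ sₑ)))
  (adjacency-outsideʳ t∉f es s)
  where
  sₑ = position s (List.map f e)

-- Vertex index k stands for v_{k+1}.  Off the hub the adjacency of T³ₙ is 2-periodic:
-- spoke b = a_{1,b+2} and rim a b = a_{a+2,b+2}.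
spoke : ℕ → ℕ
spoke zero          = 1
spoke (suc zero)    = 2
spoke (suc (suc b)) = spoke b

rim : ℕ → ℕ → ℕ
rim zero          (suc zero)    = 1
rim (suc zero)    zero          = 1
rim (suc (suc a)) (suc (suc b)) = rim a b
rim _             _             = 0

T3adj : ℕ → ℕ → ℕ
T3adj zero    zero    = 0
T3adj zero    (suc b) = spoke b
T3adj (suc a) zero    = spoke a
T3adj (suc a) (suc b) = rim a b

spoke-double : ∀ n j → spoke (double n ℕ.+ j) ≡ spoke j
spoke-double zero    j = refl
spoke-double (suc n) j = spoke-double n j

rim-double : ∀ n i j → rim (double n ℕ.+ i) (double n ℕ.+ j) ≡ rim i j
rim-double zero    i j = refl
rim-double (suc n) i j = rim-double n i j

rim-offBlockʳ : ∀ n {k} j → k ℕ.< double n → rim k (double n ℕ.+ j) ≡ 0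
rim-offBlockʳ (suc n) {zero}        j _    = refl
rim-offBlockʳ (suc n) {suc zero}    j _    = refl
rim-offBlockʳ (suc n) {suc (suc k)} j k<2n = rim-offBlockʳ n j (ℕ.s<s⁻¹ (ℕ.s<s⁻¹ k<2n))

rim-offBlockˡ : ∀ n {k} j → k ℕ.< double n → rim (double n ℕ.+ j) k ≡ 0
rim-offBlockˡ (suc n) {zero}        j _    = refl
rim-offBlockˡ (suc n) {suc zero}    j _    = refl
rim-offBlockˡ (suc n) {suc (suc k)} j k<2n = rim-offBlockˡ n j (ℕ.s<s⁻¹ (ℕ.s<s⁻¹ k<2n))

embed : ∀ {m} → Fin m → Fin (suc (suc m))
embed v = inject₁ (inject₁ v)

embed-injective : ∀ {m} → Injective _≡_ _≡_ (embed {m})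
embed-injective = Fin.inject₁-injective ∘ Fin.inject₁-injective

newVertex₁ newVertex₂ : ∀ m → Fin (suc (suc m))
newVertex₁ m = inject₁ (fromℕ m)
newVertex₂ m = fromℕ (suc m)

newEdge : ∀ m → Edge (suc (suc m))
newEdge m = zero ∷ newVertex₁ m ∷ newVertex₂ m ∷ []

newVertex₁≢embed : ∀ {m} (a : Fin m) → newVertex₁ m ≢ embed a
newVertex₁≢embed a = Fin.fromℕ≢inject₁ ∘ Fin.inject₁-injective

newVertex₂≢embed : ∀ {m} (a : Fin m) → newVertex₂ m ≢ embed a
newVertex₂≢embed a = Fin.fromℕ≢inject₁

data ExtendedVertex (p : ℕ) : Fin (suc (suc (suc p))) → Set where
  old  : (a : Fin (suc p)) → ExtendedVertex p (embed a)
  new₁ : ExtendedVertex p (newVertex₁ (suc p))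
  new₂ : ExtendedVertex p (newVertex₂ (suc p))

extendedVertex : ∀ {p} (s : Fin (suc (suc (suc p)))) → ExtendedVertex p s
extendedVertex zero                     = old zero
extendedVertex {zero}  (suc zero)       = new₁
extendedVertex {zero}  (suc (suc zero)) = new₂
extendedVertex {suc p} (suc s) with extendedVertex {p} s
... | old a = old (suc a)
... | new₁  = new₁
... | new₂  = new₂

positionInNewEdge : ∀ {p s} → ExtendedVertex p s → Maybe ℕ
positionInNewEdge (old zero)    = just 0
positionInNewEdge (old (suc _)) = nothing
positionInNewEdge new₁          = just 1
positionInNewEdge new₂          = just 2

position-newEdge : ∀ {p s} (v : ExtendedVertex p s) → position s (newEdge (suc p)) ≡ positionInNewEdge v
position-newEdge (old zero) = refl
position-newEdge {p} (old (suc k)) = begin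
  position v (zero ∷ n₁ ∷ n₂ ∷ [])                      ≡⟨ position-there v zero (n₁ ∷ n₂ ∷ []) (λ ()) ⟩
  Maybe.map suc (position v (n₁ ∷ n₂ ∷ []))             ≡⟨ cong (Maybe.map suc)
                                                             (position-there v n₁ (n₂ ∷ []) (newVertex₁≢embed (suc k) ∘ sym)) ⟩
  Maybe.map suc (Maybe.map suc (position v (n₂ ∷ []))) ≡⟨ cong (Maybe.map suc ∘ Maybe.map suc)
                                                             (position-there v n₂ [] (newVertex₂≢embed (suc k) ∘ sym)) ⟩
  nothing                                               ∎
  where
  open ≡-Reasoning
  v  = embed (suc k)
  n₁ = newVertex₁ (suc p)
  n₂ = newVertex₂ (suc p)
position-newEdge {p} new₁ = begin
  position n₁ (zero ∷ n₁ ∷ n₂ ∷ [])          ≡⟨ position-there n₁ zero (n₁ ∷ n₂ ∷ []) (λ ()) ⟩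
  Maybe.map suc (position n₁ (n₁ ∷ n₂ ∷ [])) ≡⟨ cong (Maybe.map suc) (position-here n₁ n₁ (n₂ ∷ []) refl) ⟩
  just 1                                     ∎
  where
  open ≡-Reasoning
  n₁ = newVertex₁ (suc p)
  n₂ = newVertex₂ (suc p)
position-newEdge {p} new₂ = begin
  position n₂ (zero ∷ n₁ ∷ n₂ ∷ [])                      ≡⟨ position-there n₂ zero (n₁ ∷ n₂ ∷ []) (λ ()) ⟩
  Maybe.map suc (position n₂ (n₁ ∷ n₂ ∷ []))             ≡⟨ cong (Maybe.map suc)
                                                             (position-there n₂ n₁ (n₂ ∷ []) Fin.fromℕ≢inject₁) ⟩
  Maybe.map suc (Maybe.map suc (position n₂ (n₂ ∷ []))) ≡⟨ cong (Maybe.map suc ∘ Maybe.map suc)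
                                                             (position-here n₂ n₂ [] refl) ⟩
  just 2                                                ∎
  where
  open ≡-Reasoning
  n₁ = newVertex₁ (suc p)
  n₂ = newVertex₂ (suc p)

-- The new vertices have index p + 1 and p + 2, written so that the lemmas about double n + j apply.
indexOf : ∀ {p s} → ExtendedVertex p s → ℕ
indexOf     (old a) = toℕ a
indexOf {p} new₁    = suc (p ℕ.+ 0)
indexOf {p} new₂    = suc (p ℕ.+ 1)

toℕ-extendedVertex : ∀ {p s} (v : ExtendedVertex p s) → toℕ s ≡ indexOf v
toℕ-extendedVertex     (old a) = trans (Fin.toℕ-inject₁ (inject₁ a)) (Fin.toℕ-inject₁ a)
toℕ-extendedVertex {p} new₁    =
  cong suc (trans (Fin.toℕ-inject₁ (fromℕ p)) (trans (Fin.toℕ-fromℕ p) (sym (ℕ.+-identityʳ p))))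
toℕ-extendedVertex {p} new₂    = trans (Fin.toℕ-fromℕ (suc (suc p))) (cong suc (ℕ.+-comm 1 p))

AdjacencyKernel : ∀ {m} → (ℕ → ℕ → ℕ) → List (Edge m) → Set
AdjacencyKernel K es = ∀ s t → adjacency ⟨ es ⟩ s t ≡ + K (toℕ s) (toℕ t)

oldAdjacency : ∀ {p s t} → ExtendedVertex p s → ExtendedVertex p t → ℕ
oldAdjacency (old a) (old b) = T3adj (toℕ a) (toℕ b)
oldAdjacency _       _       = 0

adjacency-oldEdges : ∀ {p} (es : List (Edge (suc p))) → AdjacencyKernel T3adj es →
  ∀ {s t} (v : ExtendedVertex p s) (w : ExtendedVertex p t) →
  adjacency ⟨ List.map (List.map embed) es ⟩ s t ≡ + oldAdjacency v w
adjacency-oldEdges es adjacency≡ (old a) (old b) = trans (adjacency-relabel embed-injective es a b) (adjacency≡ a b)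
adjacency-oldEdges es adjacency≡ (old a) new₁    = adjacency-outsideʳ newVertex₁≢embed es _
adjacency-oldEdges es adjacency≡ (old a) new₂    = adjacency-outsideʳ newVertex₂≢embed es _
adjacency-oldEdges es adjacency≡ new₁    _       = adjacency-outsideˡ newVertex₁≢embed es _
adjacency-oldEdges es adjacency≡ new₂    _       = adjacency-outsideˡ newVertex₂≢embed es _

T3adj-split : ∀ n {s t} (v : ExtendedVertex (double n) s) (w : ExtendedVertex (double n) t) →
  maybeDist (positionInNewEdge v) (positionInNewEdge w) ℕ.+ oldAdjacency v w ≡ T3adj (indexOf v) (indexOf w)
T3adj-split n (old zero)    (old zero)    = refl
T3adj-split n (old zero)    (old (suc _)) = refl
T3adj-split n (old (suc _)) (old _)       = refl
T3adj-split n (old zero)    new₁          = sym (spoke-double n 0)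
T3adj-split n (old zero)    new₂          = sym (spoke-double n 1)
T3adj-split n (old (suc k)) new₁          = sym (rim-offBlockʳ n 0 (Fin.toℕ<n k))
T3adj-split n (old (suc k)) new₂          = sym (rim-offBlockʳ n 1 (Fin.toℕ<n k))
T3adj-split n new₁          (old zero)    = sym (spoke-double n 0)
T3adj-split n new₂          (old zero)    = sym (spoke-double n 1)
T3adj-split n new₁          (old (suc k)) = sym (rim-offBlockˡ n 0 (Fin.toℕ<n k))
T3adj-split n new₂          (old (suc k)) = sym (rim-offBlockˡ n 1 (Fin.toℕ<n k))
T3adj-split n new₁          new₁          = sym (rim-double n 0 0)
T3adj-split n new₁          new₂          = sym (rim-double n 0 1)
T3adj-split n new₂          new₁          = sym (rim-double n 1 0)
T3adj-split n new₂          new₂          = sym (rim-double n 1 1)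

T3adj-addEdge : ∀ n {m} (es : List (Edge m)) → m ≡ suc (double n) →
  AdjacencyKernel T3adj es → AdjacencyKernel T3adj (newEdge m ∷ List.map (List.map embed) es)
T3adj-addEdge n es refl adjacency≡ s t = begin
  + edgeDist (newEdge (suc (double n))) s t + adjacency ⟨ List.map (List.map embed) es ⟩ s t
    ≡⟨ cong₂ (λ d r → + d + r) newPart (adjacency-oldEdges es adjacency≡ v w) ⟩
  + (maybeDist (positionInNewEdge v) (positionInNewEdge w) ℕ.+ oldAdjacency v w)
    ≡⟨ cong +_ (T3adj-split n v w) ⟩
  + T3adj (indexOf v) (indexOf w)
    ≡⟨ cong₂ (λ a b → + T3adj a b) (toℕ-extendedVertex v) (toℕ-extendedVertex w) ⟨
  + T3adj (toℕ s) (toℕ t) ∎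
  where
  open ≡-Reasoning
  v = extendedVertex s
  w = extendedVertex t
  newPart : edgeDist (newEdge (suc (double n))) s t ≡ maybeDist (positionInNewEdge v) (positionInNewEdge w)
  newPart = trans (edgeDist≡maybeDist (newEdge (suc (double n))) s t)
                  (cong₂ maybeDist (position-newEdge v) (position-newEdge w))

V≡suc-double : ∀ n → V n ≡ suc (double n)
V≡suc-double zero    = refl
V≡suc-double (suc n) = cong (λ k → suc (suc k)) (V≡suc-double n)

adjacency-T3 : ∀ n → AdjacencyKernel T3adj (T3edges n)
adjacency-T3 zero    zero zero = refl
adjacency-T3 (suc n) = T3adj-addEdge n (T3edges n) (V≡suc-double n) (adjacency-T3 n)

T3deg : ℕ → ℕ → ℕ
T3deg n zero    = 3 ℕ.* n
T3deg n (suc a) = suc (spoke a)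

∑-rimRow : ∀ n {a} → a ℕ.< double n → ∑ {double n} (λ t → + rim a (toℕ t)) ≡ + 1
∑-rimRow (suc n) {zero}        _    = cong (λ r → + 0 + (+ 1 + r)) (∑-zero {double n} λ _ → refl)
∑-rimRow (suc n) {suc zero}    _    = cong (λ r → + 1 + (+ 0 + r)) (∑-zero {double n} λ _ → refl)
∑-rimRow (suc n) {suc (suc a)} a<2n = cong (λ r → + 0 + (+ 0 + r)) (∑-rimRow n (ℕ.s<s⁻¹ (ℕ.s<s⁻¹ a<2n)))

∑-T3adjRow : ∀ n {a} → a ℕ.< suc (double n) → ∑ {suc (double n)} (λ t → + T3adj a (toℕ t)) ≡ + T3deg n a
∑-T3adjRow n {zero} _ = begin
  + 0 + ∑ {double n} (λ t → + spoke (toℕ t)) ≡⟨ ℤ.+-identityˡ _ ⟩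
  ∑ {double n} (λ t → + spoke (toℕ t))       ≡⟨ ∑-periodic (λ a → + spoke a) (λ _ → refl) n ⟩
  + n * + 3                                  ≡⟨ ℤ.pos-* n 3 ⟨
  + (n ℕ.* 3)                                ≡⟨ cong +_ (ℕ.*-comm n 3) ⟩
  + (3 ℕ.* n)                                ∎
  where open ≡-Reasoning
∑-T3adjRow n {suc a} a<2n+1 =
  trans (cong (_+_ (+ spoke a)) (∑-rimRow n (ℕ.s<s⁻¹ a<2n+1))) (cong +_ (ℕ.+-comm (spoke a) 1))

degree-T3 : ∀ n (s : Fin (V n)) → degree (T3 n) s ≡ + T3deg n (toℕ s)
degree-T3 n s = begin
  ∑ (adjacency (T3 n) s)
    ≡⟨ ∑-cong (adjacency-T3 n s) ⟩
  ∑ {V n} (λ t → + T3adj (toℕ s) (toℕ t))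
    ≡⟨ cong (λ k → ∑ {k} λ t → + T3adj (toℕ s) (toℕ t)) (V≡suc-double n) ⟩
  ∑ {suc (double n)} (λ t → + T3adj (toℕ s) (toℕ t))
    ≡⟨ ∑-T3adjRow n (subst (toℕ s ℕ.<_) (V≡suc-double n) (Fin.toℕ<n s)) ⟩
  + T3deg n (toℕ s) ∎
  where open ≡-Reasoning

δℕ : ℕ → ℕ → ℕ
δℕ zero    zero    = 1
δℕ zero    (suc b) = 0
δℕ (suc a) zero    = 0
δℕ (suc a) (suc b) = δℕ a b

δℕ-refl : ∀ a → δℕ a a ≡ 1
δℕ-refl zero    = refl
δℕ-refl (suc a) = δℕ-refl a

δℕ-≢ : ∀ {a b} → a ≢ b → δℕ a b ≡ 0
δℕ-≢ {zero}  {zero}  a≢b = contradiction refl a≢b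
δℕ-≢ {zero}  {suc b} a≢b = refl
δℕ-≢ {suc a} {zero}  a≢b = refl
δℕ-≢ {suc a} {suc b} a≢b = δℕ-≢ (a≢b ∘ cong suc)

δ≡δℕ : ∀ {m} (s t : Fin m) → δ s t ≡ + δℕ (toℕ s) (toℕ t)
δ≡δℕ s t with s Fin.≟ t
... | yes refl = cong +_ (sym (δℕ-refl (toℕ s)))
... | no  s≢t  = cong +_ (sym (δℕ-≢ (s≢t ∘ Fin.toℕ-injective)))

charKernel : ℤ → ℕ → ℕ → ℕ → ℤ
charKernel x n a b = + δℕ a b * (x - + T3deg n a) + + T3adj a b

charMatrix-entry : ∀ x n (s t : Fin (V n)) → δ s t * x - laplacian (T3 n) s t ≡ charKernel x n (toℕ s) (toℕ t)
charMatrix-entry x n s t rewrite δ≡δℕ s t | degree-T3 n s | adjacency-T3 n s t =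
  ring (+ δℕ (toℕ s) (toℕ t)) x (+ T3deg n (toℕ s)) (+ T3adj (toℕ s) (toℕ t))
  where
  ring : ∀ d x D A → d * x - (d * D - A) ≡ d * (x - D) + A
  ring = solve-∀

blockPoly : ℤ → ℤ
blockPoly x = x * x - + 5 * x + + 5

hubPoly : ℕ → ℤ → ℤ
hubPoly n x = x * x - + (3 ℕ.* n ℕ.+ 5) * x + + (10 ℕ.* n ℕ.+ 5)

-- (5 − x, 5 − 2x) = −(1, 2) · adj B₀, repeated once per block.
eliminator : ℤ → ℕ → ℤ
eliminator x zero          = + 5 - x
eliminator x (suc zero)    = + 5 - + 2 * x
eliminator x (suc (suc a)) = eliminator x a

eliminator-spokeColumn : ∀ x n (k : Fin (double n)) →
  ∑ {double n} (λ i → eliminator x (toℕ i) * charKernel x n (suc (toℕ i)) (suc (toℕ k)))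
    ≡ - (blockPoly x * + spoke (toℕ k))
eliminator-spokeColumn x (suc n) zero =
  trans (cong (λ r → (+ 5 - x) * (+ 1 * (x - + 2) + + 0) + ((+ 5 - + 2 * x) * + 1 + r))
              (∑-zero {double n} λ i → ℤ.*-zeroʳ (eliminator x (toℕ i))))
        (ring x)
  where
  ring : ∀ x → (+ 5 - x) * (+ 1 * (x - + 2) + + 0) + ((+ 5 - + 2 * x) * + 1 + + 0) ≡ - ((x * x - + 5 * x + + 5) * + 1)
  ring = solve-∀
eliminator-spokeColumn x (suc n) (suc zero) =
  trans (cong (λ r → (+ 5 - x) * + 1 + ((+ 5 - + 2 * x) * (+ 1 * (x - + 3) + + 0) + r))
              (∑-zero {double n} λ i → ℤ.*-zeroʳ (eliminator x (toℕ i))))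
        (ring x)
  where
  ring : ∀ x → (+ 5 - x) * + 1 + ((+ 5 - + 2 * x) * (+ 1 * (x - + 3) + + 0) + + 0) ≡ - ((x * x - + 5 * x + + 5) * + 2)
  ring = solve-∀
eliminator-spokeColumn x (suc n) (suc (suc k)) =
  trans (ring (+ 5 - x) (+ 5 - + 2 * x) _) (eliminator-spokeColumn x n k)
  where
  ring : ∀ a b r → a * + 0 + (b * + 0 + r) ≡ r
  ring = solve-∀

eliminator-hubColumn : ∀ x n →
  ∑ {double n} (λ i → eliminator x (toℕ i) * charKernel x n (suc (toℕ i)) 0) ≡ + n * (+ 15 - + 5 * x)
eliminator-hubColumn x n =
  trans (∑-periodic (λ a → eliminator x a * + spoke a) (λ _ → refl) n) (cong (+ n *_) (ring x))
  where
  ring : ∀ x → (+ 5 - x) * + 1 + (+ 5 - + 2 * x) * + 2 ≡ + 15 - + 5 * x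
  ring = solve-∀

5≢square : ∀ k → k ℕ.* k ≢ 5
5≢square 0 ()
5≢square 1 ()
5≢square 2 ()
5≢square (suc (suc (suc k))) k²≡5 =
  from-no (9 ℕ.≤? 5) (subst (9 ℕ.≤_) k²≡5 (ℕ.*-mono-≤ (ℕ.m≤m+n 3 k) (ℕ.m≤m+n 3 k)))

blockPoly≢0 : ∀ x → blockPoly x ≢ + 0
blockPoly≢0 x D≡0 = 5≢square ℤ.∣ 2x-5 ∣ (begin
  ℤ.∣ 2x-5 ∣ ℕ.* ℤ.∣ 2x-5 ∣     ≡⟨ ℤ.abs-* 2x-5 2x-5 ⟨
  ℤ.∣ 2x-5 * 2x-5 ∣             ≡⟨ cong ℤ.∣_∣ (square x) ⟩
  ℤ.∣ + 4 * blockPoly x + + 5 ∣ ≡⟨ cong (λ d → ℤ.∣ + 4 * d + + 5 ∣) D≡0 ⟩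
  5                             ∎)
  where
  open ≡-Reasoning
  2x-5 = + 2 * x - + 5
  square : ∀ x → (+ 2 * x - + 5) * (+ 2 * x - + 5) ≡ + 4 * (x * x - + 5 * x + + 5) + + 5
  square = solve-∀

det-charMatrix : ∀ x m → let n = suc m in
  det (toMatrix {suc (double n)} (charKernel x n)) ≡ x * blockPoly x ^ m * hubPoly n x
det-charMatrix x m = ℤ.*-cancelˡ-≡ D (det M) (x * D ^ m * hubPoly n x) {{ℤ.≢-nonZero (blockPoly≢0 x)}} (begin
  D * det M
    ≡⟨ det-eliminateRow0 M D (eliminator x ∘ toℕ) spokesCleared ⟩
  (D * M zero zero + ∑ (λ i → eliminator x (toℕ i) * M (suc i) zero)) * det (minor M zero)
    ≡⟨ cong₂ (λ h b → (D * M zero zero + h) * b) (eliminator-hubColumn x n) blocks ⟩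
  (D * (+ 1 * (x - + (3 ℕ.* n)) + + 0) + + n * (+ 15 - + 5 * x)) * D ^ n
    ≡⟨ collect ⟩
  D * (x * D ^ m * hubPoly n x) ∎)
  where
  open ≡-Reasoning
  n = suc m
  D = blockPoly x
  M : Matrix (suc (double n))
  M = toMatrix (charKernel x n)
  spokesCleared : ∀ k → D * M zero (suc k) + ∑ (λ i → eliminator x (toℕ i) * M (suc i) (suc k)) ≡ + 0
  spokesCleared k =
    trans (cong (_+_ (D * + spoke (toℕ k))) (eliminator-spokeColumn x n k)) (ℤ.+-inverseʳ (D * + spoke (toℕ k)))
  blocks : det (minor M zero) ≡ D ^ n
  blocks = trans (det-blockLowerTriangular (λ a b → charKernel x n (suc a) (suc b)) (λ _ _ → refl) (λ _ → refl) (λ _ → refl) n)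
                 (cong (_^ n) (ring x))
    where
    ring : ∀ x → (+ 1 * (x - + 2) + + 0) * (+ 1 * (x - + 3) + + 0) - + 1 * + 1 ≡ x * x - + 5 * x + + 5
    ring = solve-∀
  collect : (D * (+ 1 * (x - + (3 ℕ.* n)) + + 0) + + n * (+ 15 - + 5 * x)) * D ^ n ≡ D * (x * D ^ m * hubPoly n x)
  collect rewrite ℤ.pos-+ (3 ℕ.* n) 5 | ℤ.pos-+ (10 ℕ.* n) 5 | ℤ.pos-* 3 n | ℤ.pos-* 10 n = ring x (+ n) (D ^ m)
    where
    ring : ∀ x N E → ((x * x - + 5 * x + + 5) * (+ 1 * (x - + 3 * N) + + 0) + N * (+ 15 - + 5 * x)) * ((x * x - + 5 * x + + 5) * E)
                   ≡ (x * x - + 5 * x + + 5) * (x * E * (x * x - (+ 3 * N + + 5) * x + (+ 10 * N + + 5)))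
    ring = solve-∀

mainTheorem6 : (n : ℕ) → 1 ≤ n → (x : ℤ) →
    laplacianCharPoly (T3 n) x
      ≡ x * (x * x - + 5 * x + + 5) ^ (n ∸ 1)
          * (x * x - + (3 ℕ.* n ℕ.+ 5) * x + + (10 ℕ.* n ℕ.+ 5))
mainTheorem6 (suc m) _ x = begin
  det (λ s t → δ s t * x - laplacian (T3 n) s t)   ≡⟨ det-cong (charMatrix-entry x n) ⟩
  det (toMatrix {V n} (charKernel x n))            ≡⟨ cong (λ k → det (toMatrix {k} (charKernel x n))) (V≡suc-double n) ⟩
  det (toMatrix {suc (double n)} (charKernel x n)) ≡⟨ det-charMatrix x m ⟩
  x * blockPoly x ^ m * hubPoly n x                ∎
  where
  open ≡-Reasoning
  n = suc m
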